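{- Let $G$ be an abelian group of order $2n$, $\mathcal{E}\subset G$ a subgroup of index $2$, $\mathcal{O}=G\setminus\mathcal{E}$, and $W=\{a+a:a\in\mathcal{O}\}$. For every $x\in\mathcal{E}$ with $x\neq0$, $$e(\mathcal{G}_x)=n-\frac{r(\mathcal{O})}{2}-\frac{r(\mathcal{E})}{2}\mathbb{1}[x\in W]+\Big(\frac{n-r(\mathcal{O})}{2}\Big)\mathbb{1}[x\notin R(G)],$$ and the maximum degree of $\mathcal{G}_x$ is at most $3$.
   Context: For $X\subset G$: $R(X)=\{x\in X:x=-x\}$ and $r(X)=|R(X)|$. For $x\in\mathcal{E}$, $\mathcal{G}_x$ is the graph with vertex set $\mathcal{O}$ and edge set $\{\{y,z\}:y\neq z\in\mathcal{O},\ y+z=x\text{ or }y-z=x\}$ (no loops); $e(\cdot)$ is the number of edges. -}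

module Defs where

open import Level using (Level)
open import Algebra.Bundles using (AbelianGroup)
open import Function.Bundles using (Inverse)
open import Relation.Binary.PropositionalEquality as ≡ using (_≡_)
open import Relation.Binary.Definitions using (Decidable)
open import Relation.Nullary using (yes; no; ¬_)
open import Relation.Nullary.Decidable using (⌊_⌋)
open import Data.Nat using (ℕ; _*_; _<ᵇ_)
open import Data.Integer as ℤ using (ℤ)
open import Data.Fin using (Fin; toℕ)
open import Data.Fin.Properties as FinP using ()
open import Data.Bool using (Bool; true; false; _∧_; _∨_; not; if_then_else_)
open import Data.List using (List; map; length; filterᵇ; allFin; cartesianProduct)
open import Data.Bool.ListAction using (any)
open import Data.Product using (_×_; _,_)

𝟙 : Bool → ℤ
𝟙 true  = ℤ.+ 1
𝟙 false = ℤ.+ 0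

-- A finite abelian group G, enumerated by a bijection (setoid inverse) with Fin m
-- (so |G| = m).  Subsets of G are Bool-valued predicates.
module FiniteAbGroup {c ℓ : Level} (G : AbelianGroup c ℓ) (m : ℕ)
         (enum : Inverse (AbelianGroup.setoid G) (≡.setoid (Fin m))) where

  open AbelianGroup G
  open Inverse enum using (to; from; to-cong; from-cong; strictlyInverseʳ)

  _≈?_ : Decidable _≈_
  x ≈? y with to x FinP.≟ to y
  ... | yes p = yes (trans (sym (strictlyInverseʳ x))
                     (trans (from-cong p) (strictlyInverseʳ y)))
  ... | no ¬p = no (λ q → ¬p (to-cong q))

  _==_ : Carrier → Carrier → Bool
  x == y = ⌊ x ≈? y ⌋

  elems : List Carrier
  elems = map from (allFin m)

  count : (Carrier → Bool) → ℕ
  count X = length (filterᵇ X elems)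

  record IsSubgroup (H : Carrier → Bool) : Set (c Level.⊔ ℓ) where
    field
      respects : ∀ {x y} → x ≈ y → H x ≡ H y
      ε-mem    : H ε ≡ true
      ∙-mem    : ∀ {x y} → H x ≡ true → H y ≡ true → H (x ∙ y) ≡ true
      ⁻¹-mem   : ∀ {x} → H x ≡ true → H (x ⁻¹) ≡ true

  HasIndex2 : (Carrier → Bool) → Set
  HasIndex2 H = m ≡ 2 * count H

  inR : (Carrier → Bool) → Carrier → Bool
  inR X a = X a ∧ (a == (a ⁻¹))

  r : (Carrier → Bool) → ℕ
  r X = count (inR X)

  everything : Carrier → Bool
  everything _ = true

  module WithEven (E : Carrier → Bool) where

    O : Carrier → Bool
    O a = not (E a)

    inW : Carrier → Bool
    inW x = any (λ a → O a ∧ ((a ∙ a) == x)) elems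

    -- adjacency in 𝒢_x: y ≠ z in 𝒪 with y + z = x or y - z = x
    -- (edges are unordered pairs, so y - z = x or z - y = x)
    adj : Carrier → Carrier → Carrier → Bool
    adj x y z = O y ∧ O z ∧ not (y == z)
                ∧ (((y ∙ z) == x) ∨ ((y ∙ (z ⁻¹)) == x) ∨ ((z ∙ (y ⁻¹)) == x))

    -- e(𝒢_x): number of unordered pairs {y, z}, enumerated as index pairs i < j
    edges : Carrier → ℕ
    edges x = length (filterᵇ
      (λ { (i , j) → (toℕ i <ᵇ toℕ j) ∧ adj x (from i) (from j) })
      (cartesianProduct (allFin m) (allFin m)))

    degree : Carrier → Carrier → ℕ
    degree x y = count (adj x y)

module Submission where

-- An odd vertex y of 𝒢_x is adjacent exactly to the z ≠ y among x − y, y − x,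
-- x + y; these are odd since x is even, and differ from y since x ≠ 0.
-- Inclusion–exclusion over their coincidences (2y = x, y = −y,
-- y − x = −(y − x), x = −x) gives, with k = [x ≠ −x],
--      deg y + [2y = x] + [y = −y] + k·[y − x = −(y − x)] = 2 + k,
-- which bounds the degree by 3.  Summed over y ∈ 𝒪, the degrees give 2e(𝒢_x)
-- (handshake lemma), both involution counts give r(𝒪) (y ↦ y − x permutes 𝒪),
-- and ∑ [2y = x] = r(ℰ)·[x ∈ W] (if x = 2a, w ↦ w + a maps ℰ onto 𝒪).

open import Defs
open import Level using (Level)
open import Algebra.Bundles using (AbelianGroup)
open import Function.Bundles using (Inverse)
open import Relation.Binary.PropositionalEquality as ≡ using (_≡_)
open import Relation.Nullary using (¬_)
open import Data.Nat using (ℕ; _*_; _≤_)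
open import Data.Integer as ℤ using (ℤ)
open import Data.Fin using (Fin)
open import Data.Bool using (true; not)
open import Data.Product using (_×_)

open import Algebra.Bundles using (Group)
open import Data.Bool using (Bool; false; _∧_; _∨_)
import Data.Bool.Properties as BoolP
open import Data.Bool.ListAction using (any)
open import Data.Empty using (⊥-elim)
open import Data.Fin using (zero; suc; toℕ)
import Data.Fin.Permutation as Perm
import Data.Fin.Properties as FinP
open import Data.Integer.Properties using (pos-+; pos-*)
open import Data.Integer.Tactic.RingSolver using () renaming (solve-∀ to ℤ-solve)
open import Data.List as List using (List; []; _∷_; _++_; length; filterᵇ; tabulate; allFin; cartesianProduct)
import Data.List.Properties as ListP
open import Data.Nat using (zero; suc; _+_; _<_; _<ᵇ_; z≤n; s≤s)
import Data.Nat.Properties as ℕP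
open import Algebra.Properties.Semiring.Sum ℕP.+-*-semiring
  using (sum; sum-cong-≗; ∑-distrib-+; ∑-comm; sum-permute; *-distribˡ-sum)
open import Data.Product using (∃; _,_)
open import Function using (_∘_; id)
open import Relation.Binary.Bundles using (Setoid)
open import Relation.Binary.Definitions using (Decidable; tri<; tri≈; tri>)
open import Relation.Binary.PropositionalEquality using (refl)
open import Relation.Nullary using (yes; no)
open import Relation.Nullary.Decidable using (⌊_⌋; T?)

⟦_⟧ : Bool → ℕ
⟦ true  ⟧ = 1
⟦ false ⟧ = 0

⟦⟧≤1 : ∀ b → ⟦ b ⟧ ≤ 1
⟦⟧≤1 true  = s≤s z≤n
⟦⟧≤1 false = z≤n

bool-ext : ∀ {p q : Bool} → (p ≡ true → q ≡ true) → (q ≡ true → p ≡ true) → p ≡ q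
bool-ext {true}  {true}  _   _   = refl
bool-ext {true}  {false} p⇒q _   = ≡.sym (p⇒q refl)
bool-ext {false} {true}  _   q⇒p = q⇒p refl
bool-ext {false} {false} _   _   = refl

⟦⟧≡1 : ∀ {b} → ⟦ b ⟧ ≡ 1 → b ≡ true
⟦⟧≡1 {true} _ = refl

not-true : ∀ {b} → not b ≡ true → b ≡ false
not-true {false} _ = refl

⟦not⟧+⟦⟧ : ∀ b → ⟦ not b ⟧ + ⟦ b ⟧ ≡ 1
⟦not⟧+⟦⟧ true  = refl
⟦not⟧+⟦⟧ false = refl

∧-swap : ∀ p q r → p ∧ q ∧ r ≡ q ∧ p ∧ r
∧-swap true  q     r = refl
∧-swap false true  r = refl
∧-swap false false r = refl

∧-redundant : ∀ {p q : Bool} → (q ≡ true → p ≡ true) → p ∧ q ≡ q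
∧-redundant {true}  {q}     _    = refl
∧-redundant {false} {false} _    = refl
∧-redundant {false} {true}  q⇒p = q⇒p refl

-- Inclusion–exclusion for the neighbourhood {a, b, c} ∖ {y} of a vertex,
-- read at a single point z: here zy, za, zb, zc stand for z = y, z = a, ...
-- In the first table b ≠ c and y ∉ {b, c}; in the second b = c, y ≠ b.
incl-excl₃ : ∀ zy za zb zc → zy ∧ zb ≡ false → zy ∧ zc ≡ false → zb ∧ zc ≡ false →
             ⟦ not zy ∧ (za ∨ zb ∨ zc) ⟧ + ⟦ zy ∧ za ⟧ + ⟦ za ∧ zc ⟧ + ⟦ za ∧ zb ⟧
               ≡ ⟦ za ⟧ + ⟦ zb ⟧ + ⟦ zc ⟧
incl-excl₃ _     _     true  true  _  _  ()
incl-excl₃ true  _     true  _     () _  _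
incl-excl₃ true  _     _     true  _  () _
incl-excl₃ true  true  false false _  _  _ = refl
incl-excl₃ true  false false false _  _  _ = refl
incl-excl₃ false true  true  false _  _  _ = refl
incl-excl₃ false true  false true  _  _  _ = refl
incl-excl₃ false true  false false _  _  _ = refl
incl-excl₃ false false true  false _  _  _ = refl
incl-excl₃ false false false true  _  _  _ = refl
incl-excl₃ false false false false _  _  _ = refl

incl-excl₂ : ∀ zy za zb → zy ∧ zb ≡ false →
             ⟦ not zy ∧ (za ∨ zb) ⟧ + ⟦ zy ∧ za ⟧ + ⟦ za ∧ zb ⟧ ≡ ⟦ za ⟧ + ⟦ zb ⟧
incl-excl₂ true  _     true  ()
incl-excl₂ true  true  false _ = refl
incl-excl₂ true  false false _ = refl
incl-excl₂ false true  true  _ = refl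
incl-excl₂ false true  false _ = refl
incl-excl₂ false false true  _ = refl
incl-excl₂ false false false _ = refl

sum-ones : ∀ k → sum {k} (λ _ → 1) ≡ k
sum-ones zero    = refl
sum-ones (suc k) = ≡.cong suc (sum-ones k)

sum-zeros : ∀ {k} (f : Fin k → ℕ) → (∀ i → f i ≡ 0) → sum f ≡ 0
sum-zeros {zero}  f f≡0 = refl
sum-zeros {suc k} f f≡0 = ≡.cong₂ _+_ (f≡0 zero) (sum-zeros (f ∘ suc) (f≡0 ∘ suc))

sum-single : ∀ {k} (f : Fin k → ℕ) (j : Fin k) → (∀ i → ¬ i ≡ j → f i ≡ 0) → sum f ≡ f j
sum-single {suc k} f zero    others =
  ≡.trans (≡.cong (f zero +_) (sum-zeros (f ∘ suc) (λ i → others (suc i) λ ())))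
          (ℕP.+-identityʳ (f zero))
sum-single {suc k} f (suc j) others =
  ≡.cong₂ _+_ (others zero λ ())
              (sum-single (f ∘ suc) j (λ i i≢j → others (suc i) (i≢j ∘ FinP.suc-injective)))

sum-≤ : ∀ {k} (f : Fin k → ℕ) → (∀ i → f i ≤ 1) → sum f ≤ k
sum-≤ {zero}  f f≤1 = z≤n
sum-≤ {suc k} f f≤1 = ℕP.+-mono-≤ (f≤1 zero) (sum-≤ (f ∘ suc) (f≤1 ∘ suc))

sum-saturated : ∀ {k} (f : Fin k → ℕ) → (∀ i → f i ≤ 1) → sum f ≡ k → ∀ i → f i ≡ 1
sum-saturated {suc k} f f≤1 Σf≡ i
  with head-saturated (f≤1 zero) (sum-≤ (f ∘ suc) (f≤1 ∘ suc)) Σf≡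
  where
  head-saturated : ∀ {a s} → a ≤ 1 → s ≤ k → a + s ≡ suc k → a ≡ 1 × s ≡ k
  head-saturated {zero}        _         s≤k refl = ⊥-elim (ℕP.1+n≰n s≤k)
  head-saturated {suc zero}    _         _   refl = refl , refl
  head-saturated {suc (suc _)} (s≤s ()) _   _
... | f₀≡1 , rest≡k with i
...   | zero  = f₀≡1
...   | suc i = sum-saturated (f ∘ suc) (f≤1 ∘ suc) rest≡k i

module _ {a} {A : Set a} where

  count-tabulate : ∀ {k} (P : A → Bool) (g : Fin k → A) →
                   length (filterᵇ P (tabulate g)) ≡ sum (λ i → ⟦ P (g i) ⟧)
  count-tabulate {zero}  P g = refl
  count-tabulate {suc k} P g with P (g zero)
  ... | true  = ≡.cong suc (count-tabulate P (g ∘ suc))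
  ... | false = count-tabulate P (g ∘ suc)

  count-++ : (P : A → Bool) (xs ys : List A) →
             length (filterᵇ P (xs ++ ys)) ≡ length (filterᵇ P xs) + length (filterᵇ P ys)
  count-++ P xs ys = ≡.trans (≡.cong length (ListP.filter-++ (T? ∘ P) xs ys))
                             (ListP.length-++ (filterᵇ P xs))

  count-none : (P : A → Bool) (xs : List A) → any P xs ≡ false → length (filterᵇ P xs) ≡ 0
  count-none P []       _ = refl
  count-none P (x ∷ xs) none with P x
  ... | false = count-none P xs none

  any-witness : (P : A → Bool) (xs : List A) → any P xs ≡ true → ∃ λ x → P x ≡ true
  any-witness P (x ∷ xs) some with P x in Px
  ... | true  = x , Px
  ... | false = any-witness P xs some

count-cartesian : ∀ {k l} (P : Fin k × Fin l → Bool) →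
                  length (filterᵇ P (cartesianProduct (allFin k) (allFin l)))
                    ≡ sum (λ i → sum (λ j → ⟦ P (i , j) ⟧))
count-cartesian {k} {l} P = go (λ i → i)
  where
  go : ∀ {k′} (g : Fin k′ → Fin k) →
       length (filterᵇ P (cartesianProduct (tabulate g) (allFin l)))
         ≡ sum (λ i → sum (λ j → ⟦ P (g i , j) ⟧))
  go {zero}   g = refl
  go {suc k′} g = ≡.trans (count-++ P (List.map (g zero ,_) (allFin l)) _)
    (≡.cong₂ _+_ (≡.trans (≡.cong (length ∘ filterᵇ P) (ListP.map-tabulate id (g zero ,_)))
                          (count-tabulate P (g zero ,_)))
                 (go (g ∘ suc)))

<ᵇ-true : ∀ {a b} → a < b → (a <ᵇ b) ≡ true
<ᵇ-true {zero}  {suc b} _         = refl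
<ᵇ-true {suc a} {suc b} (s≤s a<b) = <ᵇ-true a<b

<ᵇ-false : ∀ {a b} → b ≤ a → (a <ᵇ b) ≡ false
<ᵇ-false {a}     {zero}  _         = refl
<ᵇ-false {suc a} {suc b} (s≤s b≤a) = <ᵇ-false b≤a

handshake : ∀ {k} (P : Fin k × Fin k → Bool) (R : Fin k → Fin k → Bool) →
            (∀ i j → P (i , j) ≡ (toℕ i <ᵇ toℕ j) ∧ R i j) →
            (∀ i j → R i j ≡ R j i) → (∀ i → R i i ≡ false) →
            2 * length (filterᵇ P (cartesianProduct (allFin k) (allFin k)))
              ≡ sum (λ i → sum (λ j → ⟦ R i j ⟧))
handshake {k} P R P≡ R-sym R-irrefl = begin
  2 * length (filterᵇ P (cartesianProduct (allFin k) (allFin k)))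
    ≡⟨ ≡.cong (2 *_) (count-cartesian P) ⟩
  2 * S                                    ≡⟨ ≡.cong (S +_) (ℕP.+-identityʳ S) ⟩
  S + S                                    ≡⟨ ≡.cong (S +_) (∑-comm (λ i j → ⟦ P (i , j) ⟧)) ⟩
  S + sum (λ i → sum (λ j → ⟦ P (j , i) ⟧)) ≡⟨ ∑-distrib-+ (λ i → sum (λ j → ⟦ P (i , j) ⟧)) _ ⟨
  sum (λ i → sum (λ j → ⟦ P (i , j) ⟧) + sum (λ j → ⟦ P (j , i) ⟧))
    ≡⟨ sum-cong-≗ (λ i → ∑-distrib-+ (λ j → ⟦ P (i , j) ⟧) _) ⟨
  sum (λ i → sum (λ j → ⟦ P (i , j) ⟧ + ⟦ P (j , i) ⟧))
    ≡⟨ sum-cong-≗ (λ i → sum-cong-≗ (one-orientation i)) ⟩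
  sum (λ i → sum (λ j → ⟦ R i j ⟧))        ∎
  where
  open ≡.≡-Reasoning
  S : ℕ
  S = sum (λ i → sum (λ j → ⟦ P (i , j) ⟧))
  -- each edge {i, j} is counted exactly once, in the orientation i < j
  one-orientation : ∀ i j → ⟦ P (i , j) ⟧ + ⟦ P (j , i) ⟧ ≡ ⟦ R i j ⟧
  one-orientation i j rewrite P≡ i j | P≡ j i with ℕP.<-cmp (toℕ i) (toℕ j)
  ... | tri< i<j _ _ rewrite <ᵇ-true i<j | <ᵇ-false (ℕP.<⇒≤ i<j) = ℕP.+-identityʳ _
  ... | tri> _ _ j<i rewrite <ᵇ-true j<i | <ᵇ-false (ℕP.<⇒≤ j<i) = ≡.cong ⟦_⟧ (R-sym j i)
  ... | tri≈ _ i≡j _ rewrite FinP.toℕ-injective i≡j | <ᵇ-false (ℕP.≤-refl {toℕ j})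
                           | R-irrefl j = refl

module FiniteSetoid {c ℓ} (S : Setoid c ℓ) {m : ℕ} (enum : Inverse S (≡.setoid (Fin m))) where

  open Setoid S using (_≈_; sym) renaming (Carrier to A)
  open Inverse enum using (to; from; to-cong; strictlyInverseˡ; strictlyInverseʳ)

  total : (A → ℕ) → ℕ
  total f = sum (λ i → f (from i))

  total-cong : ∀ {f g : A → ℕ} → (∀ u → f u ≡ g u) → total f ≡ total g
  total-cong f≗g = sum-cong-≗ {m} (f≗g ∘ from)

  total-+ : (f g : A → ℕ) → total (λ u → f u + g u) ≡ total f + total g
  total-+ f g = ∑-distrib-+ (f ∘ from) (g ∘ from)

  total-* : (k : ℕ) (f : A → ℕ) → total (λ u → k * f u) ≡ k * total f
  total-* k f = ≡.sym (*-distribˡ-sum k (f ∘ from))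

  total-+₃ : (f g h : A → ℕ) → total (λ u → f u + g u + h u) ≡ total f + total g + total h
  total-+₃ f g h = ≡.trans (total-+ (λ u → f u + g u) h) (≡.cong (_+ total h) (total-+ f g))

  total-+₄ : (f g h k : A → ℕ) →
             total (λ u → f u + g u + h u + k u) ≡ total f + total g + total h + total k
  total-+₄ f g h k = ≡.trans (total-+ (λ u → f u + g u + h u) k) (≡.cong (_+ total k) (total-+₃ f g h))

  total-zeros : ∀ {f : A → ℕ} → (∀ u → f u ≡ 0) → total f ≡ 0
  total-zeros f≡0 = sum-zeros _ (f≡0 ∘ from)

  total-ones : total (λ _ → 1) ≡ m
  total-ones = sum-ones m

  count-total : (X : A → Bool) →
                length (filterᵇ X (List.map from (allFin m))) ≡ total (λ u → ⟦ X u ⟧)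
  count-total X = ≡.trans (≡.cong (length ∘ filterᵇ X) (ListP.map-tabulate id from))
                          (count-tabulate X from)

  total-invariant : (π : Inverse S S) (f : A → ℕ) → (∀ {u v} → u ≈ v → f u ≡ f v) →
                    total f ≡ total (f ∘ Inverse.to π)
  total-invariant π f f-resp = ≡.trans (sum-permute (f ∘ from) σ)
                                       (sum-cong-≗ {m} (λ i → f-resp (strictlyInverseʳ _)))
    where
    module π = Inverse π
    σ : Perm.Permutation m m
    σ = Perm.permutation (λ i → to (π.to (from i))) (λ i → to (π.from (from i)))
      (λ i → ≡.trans (to-cong (π.to-cong (strictlyInverseʳ _)))
                     (≡.trans (to-cong (π.strictlyInverseˡ (from i))) (strictlyInverseˡ i)))
      (λ i → ≡.trans (to-cong (π.from-cong (strictlyInverseʳ _)))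
                     (≡.trans (to-cong (π.strictlyInverseʳ (from i))) (strictlyInverseˡ i)))

  total-point : (_≟_ : Decidable _≈_) (p : A) (Q : A → Bool) →
                (∀ {u v} → u ≈ v → Q u ≡ Q v) →
                total (λ z → ⟦ ⌊ z ≟ p ⌋ ∧ Q z ⟧) ≡ ⟦ Q p ⟧
  total-point _≟_ p Q Q-resp = ≡.trans (sum-single _ (to p) off-p) at-p
    where
    off-p : ∀ i → ¬ i ≡ to p → ⟦ ⌊ from i ≟ p ⌋ ∧ Q (from i) ⟧ ≡ 0
    off-p i i≢p with from i ≟ p
    ... | yes i≈p = ⊥-elim (i≢p (≡.trans (≡.sym (strictlyInverseˡ i)) (to-cong i≈p)))
    ... | no  _   = refl
    at-p : ⟦ ⌊ from (to p) ≟ p ⌋ ∧ Q (from (to p)) ⟧ ≡ ⟦ Q p ⟧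
    at-p with from (to p) ≟ p
    ... | yes _     = ≡.cong ⟦_⟧ (Q-resp (strictlyInverseʳ p))
    ... | no  p≉p = ⊥-elim (p≉p (strictlyInverseʳ p))

  total-saturated : (f : A → ℕ) → (∀ {u v} → u ≈ v → f u ≡ f v) →
                    (∀ u → f u ≤ 1) → total f ≡ m → ∀ u → f u ≡ 1
  total-saturated f f-resp f≤1 Σf≡m u =
    ≡.trans (f-resp (sym (strictlyInverseʳ u)))
            (sum-saturated (f ∘ from) (f≤1 ∘ from) Σf≡m (to u))

𝟙≡⟦⟧ : ∀ b → 𝟙 b ≡ ℤ.+ ⟦ b ⟧
𝟙≡⟦⟧ true  = refl
𝟙≡⟦⟧ false = refl

signed-form : ∀ e n r s (w b : Bool) →
              2 * e + s * ⟦ w ⟧ + r + ⟦ b ⟧ * r ≡ (2 + ⟦ b ⟧) * n →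
              ℤ.+ 2 ℤ.* ℤ.+ e
                ≡ ℤ.+ (2 * n) ℤ.- ℤ.+ r ℤ.- ℤ.+ s ℤ.* 𝟙 w ℤ.+ (ℤ.+ n ℤ.- ℤ.+ r) ℤ.* 𝟙 b
signed-form e n r s w b eq rewrite 𝟙≡⟦⟧ w | 𝟙≡⟦⟧ b | pos-* 2 n = begin
  ℤ.+ 2 ℤ.* ℤ.+ e
    ≡⟨ isolate _ (ℤ.+ s) (ℤ.+ ⟦ w ⟧) (ℤ.+ r) (ℤ.+ ⟦ b ⟧) ⟩
  ℤ.+ 2 ℤ.* ℤ.+ e ℤ.+ ℤ.+ s ℤ.* ℤ.+ ⟦ w ⟧ ℤ.+ ℤ.+ r ℤ.+ ℤ.+ ⟦ b ⟧ ℤ.* ℤ.+ r ℤ.- S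
    ≡⟨ ≡.cong (ℤ._- S) (≡.sym lhs-cast) ⟩
  ℤ.+ (2 * e + s * ⟦ w ⟧ + r + ⟦ b ⟧ * r) ℤ.- S
    ≡⟨ ≡.cong (λ t → ℤ.+ t ℤ.- S) eq ⟩
  ℤ.+ ((2 + ⟦ b ⟧) * n) ℤ.- S
    ≡⟨ ≡.cong (ℤ._- S) (≡.trans (pos-* (2 + ⟦ b ⟧) n) (≡.cong (ℤ._* ℤ.+ n) (pos-+ 2 ⟦ b ⟧))) ⟩
  (ℤ.+ 2 ℤ.+ ℤ.+ ⟦ b ⟧) ℤ.* ℤ.+ n ℤ.- S
    ≡⟨ regroup (ℤ.+ n) (ℤ.+ s) (ℤ.+ ⟦ w ⟧) (ℤ.+ r) (ℤ.+ ⟦ b ⟧) ⟩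
  ℤ.+ 2 ℤ.* ℤ.+ n ℤ.- ℤ.+ r ℤ.- ℤ.+ s ℤ.* ℤ.+ ⟦ w ⟧ ℤ.+ (ℤ.+ n ℤ.- ℤ.+ r) ℤ.* ℤ.+ ⟦ b ⟧ ∎
  where
  open ≡.≡-Reasoning
  isolate : ∀ e s w r b → e ≡ e ℤ.+ s ℤ.* w ℤ.+ r ℤ.+ b ℤ.* r ℤ.- (s ℤ.* w ℤ.+ r ℤ.+ b ℤ.* r)
  isolate = ℤ-solve

  regroup : ∀ n s w r b → (ℤ.+ 2 ℤ.+ b) ℤ.* n ℤ.- (s ℤ.* w ℤ.+ r ℤ.+ b ℤ.* r)
                            ≡ ℤ.+ 2 ℤ.* n ℤ.- r ℤ.- s ℤ.* w ℤ.+ (n ℤ.- r) ℤ.* b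
  regroup = ℤ-solve
  S : ℤ
  S = ℤ.+ s ℤ.* ℤ.+ ⟦ w ⟧ ℤ.+ ℤ.+ r ℤ.+ ℤ.+ ⟦ b ⟧ ℤ.* ℤ.+ r
  lhs-cast : ℤ.+ (2 * e + s * ⟦ w ⟧ + r + ⟦ b ⟧ * r)
               ≡ ℤ.+ 2 ℤ.* ℤ.+ e ℤ.+ ℤ.+ s ℤ.* ℤ.+ ⟦ w ⟧ ℤ.+ ℤ.+ r ℤ.+ ℤ.+ ⟦ b ⟧ ℤ.* ℤ.+ r
  lhs-cast = begin
    ℤ.+ (2 * e + s * ⟦ w ⟧ + r + ⟦ b ⟧ * r)
      ≡⟨ pos-+ (2 * e + s * ⟦ w ⟧ + r) (⟦ b ⟧ * r) ⟩
    ℤ.+ (2 * e + s * ⟦ w ⟧ + r) ℤ.+ ℤ.+ (⟦ b ⟧ * r)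
      ≡⟨ ≡.cong₂ ℤ._+_ (pos-+ (2 * e + s * ⟦ w ⟧) r) (pos-* ⟦ b ⟧ r) ⟩
    ℤ.+ (2 * e + s * ⟦ w ⟧) ℤ.+ ℤ.+ r ℤ.+ ℤ.+ ⟦ b ⟧ ℤ.* ℤ.+ r
      ≡⟨ ≡.cong (λ t → t ℤ.+ ℤ.+ r ℤ.+ ℤ.+ ⟦ b ⟧ ℤ.* ℤ.+ r)
                (≡.trans (pos-+ (2 * e) (s * ⟦ w ⟧)) (≡.cong₂ ℤ._+_ (pos-* 2 e) (pos-* s ⟦ w ⟧))) ⟩
    ℤ.+ 2 ℤ.* ℤ.+ e ℤ.+ ℤ.+ s ℤ.* ℤ.+ ⟦ w ⟧ ℤ.+ ℤ.+ r ℤ.+ ℤ.+ ⟦ b ⟧ ℤ.* ℤ.+ r ∎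

module EvenOddGraph {c ℓ} (G : AbelianGroup c ℓ) (n : ℕ)
         (enum : Inverse (AbelianGroup.setoid G) (≡.setoid (Fin (2 * n))))
         (E : AbelianGroup.Carrier G → Bool) where

  open AbelianGroup G renaming (refl to ≈-refl)
  open Group group using (_//_)
  open FiniteAbGroup G (2 * n) enum
  open WithEven E
  open FiniteSetoid setoid enum
  open Inverse enum using (from)
  open import Algebra.Properties.AbelianGroup G
    using (//-rightDividesˡ; //-rightDividesʳ; x≈z//y; ∙-cancelˡ; ⁻¹-involutive;
           ⁻¹-anti-homo-//; ⁻¹-injective; inverseˡ-unique; identityˡ-unique; ε⁻¹≈ε)
  open import Algebra.Properties.CommutativeSemigroup commutativeSemigroup using (interchange)

  ≈⇒== : ∀ {u v} → u ≈ v → (u == v) ≡ true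
  ≈⇒== {u} {v} u≈v with u ≈? v
  ... | yes _   = refl
  ... | no u≉v = ⊥-elim (u≉v u≈v)

  ==⇒≈ : ∀ {u v} → (u == v) ≡ true → u ≈ v
  ==⇒≈ {u} {v} eq with u ≈? v
  ... | yes u≈v = u≈v

  ==⇒≉ : ∀ {u v} → (u == v) ≡ false → ¬ u ≈ v
  ==⇒≉ u≠v u≈v with ≡.trans (≡.sym (≈⇒== u≈v)) u≠v
  ... | ()

  ==-⇔ : ∀ {u v u′ v′} → (u ≈ v → u′ ≈ v′) → (u′ ≈ v′ → u ≈ v) → (u == v) ≡ (u′ == v′)
  ==-⇔ to from = bool-ext (≈⇒== ∘ to ∘ ==⇒≈) (≈⇒== ∘ from ∘ ==⇒≈)

  ==-sym : ∀ {u v} → (u == v) ≡ (v == u)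
  ==-sym = ==-⇔ sym sym

  ==-congˡ : ∀ {u u′ v} → u ≈ u′ → (u == v) ≡ (u′ == v)
  ==-congˡ u≈u′ = ==-⇔ (trans (sym u≈u′)) (trans u≈u′)

  ==-congʳ : ∀ {u v v′} → v ≈ v′ → (u == v) ≡ (u == v′)
  ==-congʳ v≈v′ = ==-⇔ (λ u≈v → trans u≈v v≈v′) (λ u≈v′ → trans u≈v′ (sym v≈v′))

  ==-shift : ∀ {u v w} → ((u ∙ v) == w) ≡ (u == (w // v))
  ==-shift {u} {v} {w} = ==-⇔ (x≈z//y u v w) (λ u≈w//v → trans (∙-congʳ u≈w//v) (//-rightDividesˡ v w))

  ==-apart : ∀ {p q} z → ¬ p ≈ q → (z == p) ∧ (z == q) ≡ false
  ==-apart {p} {q} z p≉q with z ≈? p | z ≈? q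
  ... | yes z≈p | yes z≈q = ⊥-elim (p≉q (trans (sym z≈p) z≈q))
  ... | yes _   | no  _   = refl
  ... | no  _   | _       = refl

  at : Carrier → Carrier → ℕ
  at p z = ⟦ z == p ⟧

  both : Carrier → Carrier → Carrier → ℕ
  both p q z = ⟦ (z == p) ∧ (z == q) ⟧

  total-at : ∀ p → total (at p) ≡ 1
  total-at p = ≡.trans (total-cong (λ z → ≡.cong ⟦_⟧ (≡.sym (BoolP.∧-identityʳ (z == p)))))
                       (total-point _≈?_ p (λ _ → true) (λ _ → refl))

  total-both : ∀ p q → total (both p q) ≡ ⟦ p == q ⟧
  total-both p q = total-point _≈?_ p (_== q) ==-congˡ

  translation : Carrier → Inverse setoid setoid
  translation g = record
    { to        = _∙ g
    ; from      = _// g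
    ; to-cong   = ∙-congʳ
    ; from-cong = ∙-congʳ
    ; inverse   = (λ {u} v≈u//g → trans (∙-congʳ v≈u//g) (//-rightDividesˡ g u))
                , (λ {u} v≈u∙g → trans (∙-congʳ v≈u∙g) (//-rightDividesʳ g u))
    }

  module Index2 (ℰ-subgroup : IsSubgroup E) (index2 : HasIndex2 E) where
    open IsSubgroup ℰ-subgroup

    E-∙ : ∀ u {v} → E v ≡ true → E (u ∙ v) ≡ E u
    E-∙ u {v} Ev = bool-ext (λ Euv → ≡.trans (respects (sym (//-rightDividesʳ v u))) (∙-mem Euv (⁻¹-mem Ev)))
                            (λ Eu → ∙-mem Eu Ev)

    E-∙ˡ : ∀ {u} v → E u ≡ true → E (u ∙ v) ≡ E v
    E-∙ˡ {u} v Eu = ≡.trans (respects (comm u v)) (E-∙ v Eu)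

    E-⁻¹ : ∀ u → E (u ⁻¹) ≡ E u
    E-⁻¹ u = bool-ext (λ Eu⁻¹ → ≡.trans (respects (sym (⁻¹-involutive u))) (⁻¹-mem Eu⁻¹)) ⁻¹-mem

    |ℰ| : total (λ u → ⟦ E u ⟧) ≡ n
    |ℰ| = ≡.sym (≡.trans (ℕP.*-cancelˡ-≡ n (count E) 2 index2) (count-total E))

    |𝒪| : total (λ u → ⟦ O u ⟧) ≡ n
    |𝒪| = ℕP.+-cancelʳ-≡ n _ n (begin
      total (λ u → ⟦ O u ⟧) + n                      ≡⟨ ≡.cong (total (λ u → ⟦ O u ⟧) +_) |ℰ| ⟨
      total (λ u → ⟦ O u ⟧) + total (λ u → ⟦ E u ⟧) ≡⟨ total-+ (λ u → ⟦ O u ⟧) (λ u → ⟦ E u ⟧) ⟨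
      total (λ u → ⟦ O u ⟧ + ⟦ E u ⟧)               ≡⟨ total-cong (λ u → ⟦not⟧+⟦⟧ (E u)) ⟩
      total (λ _ → 1)                                ≡⟨ total-ones ⟩
      n + (n + 0)                                    ≡⟨ ≡.cong (n +_) (ℕP.+-identityʳ n) ⟩
      n + n                                          ∎)
      where open ≡.≡-Reasoning

    -- The coset argument: for a ∉ ℰ the sets ℰ and ℰ − a are disjoint and
    -- each has n elements, so together they exhaust G; thus w ∉ ℰ ⇒ w + a ∈ ℰ.
    coset : ∀ {a} → O a ≡ true → ∀ {w} → E w ≡ false → E (w ∙ a) ≡ true
    coset {a} Oa {w} Ew = ⟦⟧≡1 (≡.trans (≡.cong (λ b → ⟦ b ⟧ + ⟦ E (w ∙ a) ⟧) (≡.sym Ew))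
                                         (total-saturated f f-resp f≤1 total-f w))
      where
      f : Carrier → ℕ
      f u = ⟦ E u ⟧ + ⟦ E (u ∙ a) ⟧
      f-resp : ∀ {u v} → u ≈ v → f u ≡ f v
      f-resp u≈v = ≡.cong₂ (λ p q → ⟦ p ⟧ + ⟦ q ⟧) (respects u≈v) (respects (∙-congʳ u≈v))
      f≤1 : ∀ u → f u ≤ 1
      f≤1 u with E u in Eu
      ... | false = ⟦⟧≤1 (E (u ∙ a))
      ... | true rewrite E-∙ˡ a Eu | not-true Oa = s≤s z≤n
      total-f : total f ≡ 2 * n
      total-f = begin
        total f                                              ≡⟨ total-+ (λ u → ⟦ E u ⟧) (λ u → ⟦ E (u ∙ a) ⟧) ⟩
        total (λ u → ⟦ E u ⟧) + total (λ u → ⟦ E (u ∙ a) ⟧)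
          ≡⟨ ≡.cong (total (λ u → ⟦ E u ⟧) +_)
                    (total-invariant (translation a) (λ u → ⟦ E u ⟧) (≡.cong ⟦_⟧ ∘ respects)) ⟨
        total (λ u → ⟦ E u ⟧) + total (λ u → ⟦ E u ⟧)      ≡⟨ ≡.cong₂ _+_ |ℰ| (≡.trans |ℰ| (≡.sym (ℕP.+-identityʳ n))) ⟩
        2 * n                                                ∎
        where open ≡.≡-Reasoning

    O-∙odd : ∀ {a} → O a ≡ true → ∀ w → O (w ∙ a) ≡ E w
    O-∙odd Oa w with E w in Ew
    ... | true  = ≡.cong not (≡.trans (E-∙ˡ _ Ew) (not-true Oa))
    ... | false = ≡.cong not (coset Oa Ew)

    O-∙even : ∀ w {g} → E g ≡ true → O (w ∙ g) ≡ O w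
    O-∙even w Eg = ≡.cong not (E-∙ w Eg)

    module Vertex (x : Carrier) (Ex : E x ≡ true) (x≉ε : ¬ x ≈ ε) where

      β : Bool
      β = x == (x ⁻¹)

      module Neighbourhood (y : Carrier) (Oy : O y ≡ true) where

        x−y y−x x+y : Carrier
        x−y = x // y
        y−x = y // x
        x+y = x ∙ y

        -- The candidates are odd, because x is even.
        odd-x−y : O x−y ≡ true
        odd-x−y = ≡.trans (≡.cong not (≡.trans (E-∙ˡ (y ⁻¹) Ex) (E-⁻¹ y))) Oy

        odd-y−x : O y−x ≡ true
        odd-y−x = ≡.trans (O-∙even y (⁻¹-mem Ex)) Oy

        odd-x+y : O x+y ≡ true
        odd-x+y = ≡.trans (≡.cong not (E-∙ˡ y Ex)) Oy

        odd-if-≈ : ∀ {z w} → (z == w) ≡ true → O w ≡ true → O z ≡ true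
        odd-if-≈ z==w Ow = ≡.trans (≡.cong not (respects (==⇒≈ z==w))) Ow

        odd-if-candidate : ∀ z → ((z == x−y) ∨ (z == y−x) ∨ (z == x+y)) ≡ true → O z ≡ true
        odd-if-candidate z cand with z == x−y in p | z == y−x in q | z == x+y in r
        ... | true  | _     | _     = odd-if-≈ p odd-x−y
        ... | false | true  | _     = odd-if-≈ q odd-y−x
        ... | false | false | true  = odd-if-≈ r odd-x+y

        sum-eq : ∀ z → ((y ∙ z) == x) ≡ (z == x−y)
        sum-eq z = ≡.trans (==-congˡ (comm y z)) ==-shift

        diff-eq : ∀ z → ((y // z) == x) ≡ (z == y−x)
        diff-eq z = begin
          ((y // z) == x) ≡⟨ ==-sym ⟩
          (x == (y // z)) ≡⟨ ==-shift ⟨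
          ((x ∙ z) == y)  ≡⟨ ==-congˡ (comm x z) ⟩
          ((z ∙ x) == y)  ≡⟨ ==-shift ⟩
          (z == y−x)      ∎
          where open ≡.≡-Reasoning

        diff-eq′ : ∀ z → ((z // y) == x) ≡ (z == x+y)
        diff-eq′ z = begin
          ((z // y) == x) ≡⟨ ==-sym ⟩
          (x == (z // y)) ≡⟨ ==-shift ⟨
          ((x ∙ y) == z)  ≡⟨ ==-sym ⟩
          (z == x+y)      ∎
          where open ≡.≡-Reasoning

        adjacency : ∀ z → adj x y z ≡ not (z == y) ∧ ((z == x−y) ∨ (z == y−x) ∨ (z == x+y))
        adjacency z rewrite Oy | ==-sym {y} {z} | sum-eq z | diff-eq z | diff-eq′ z =
          ∧-redundant (odd-if-candidate z ∘ BoolP.∧-conicalʳ (not (z == y)) _)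

        y≉y−x : ¬ y ≈ y−x
        y≉y−x y≈y−x = x≉ε (⁻¹-injective (trans (sym ε≈x⁻¹) (sym ε⁻¹≈ε)))
          where
          ε≈x⁻¹ : ε ≈ x ⁻¹
          ε≈x⁻¹ = ∙-cancelˡ y ε (x ⁻¹) (trans (identityʳ y) y≈y−x)

        y≉x+y : ¬ y ≈ x+y
        y≉x+y y≈x+y = x≉ε (identityˡ-unique x y (sym y≈x+y))

        y=x−y : (y == x−y) ≡ ((y ∙ y) == x)
        y=x−y = ≡.sym ==-shift

        x−y=x+y : (x−y == x+y) ≡ (y == (y ⁻¹))
        x−y=x+y = ==-⇔ (λ eq → sym (∙-cancelˡ x (y ⁻¹) y eq)) (λ eq → ∙-congˡ (sym eq))

        x−y=y−x : (x−y == y−x) ≡ (y−x == (y−x ⁻¹))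
        x−y=y−x = ≡.trans ==-sym (==-congʳ (sym (⁻¹-anti-homo-// y x)))

        y−x=x+y : (y−x == x+y) ≡ β
        y−x=x+y = ≡.trans (==-congʳ (comm x y))
                          (==-⇔ (λ eq → sym (∙-cancelˡ y (x ⁻¹) x eq)) (λ eq → ∙-congˡ (sym eq)))

        nbr : Carrier → ℕ
        nbr z = ⟦ not (z == y) ∧ ((z == x−y) ∨ (z == y−x) ∨ (z == x+y)) ⟧

        degree-total : degree x y ≡ total nbr
        degree-total = ≡.trans (count-total (adj x y)) (total-cong (≡.cong ⟦_⟧ ∘ adjacency))

        -- x ≠ −x: then y − x ≠ x + y, and inclusion–exclusion over the three
        -- candidates gives the degree.
        degree-generic : β ≡ false →
                         degree x y + ⟦ y == x−y ⟧ + ⟦ x−y == x+y ⟧ + ⟦ x−y == y−x ⟧ ≡ 3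
        degree-generic β≡false = begin
          degree x y + ⟦ y == x−y ⟧ + ⟦ x−y == x+y ⟧ + ⟦ x−y == y−x ⟧
            ≡⟨ ≡.cong₂ _+_ (≡.cong₂ _+_ (≡.cong₂ _+_ degree-total (≡.sym (total-both y x−y)))
                                        (≡.sym (total-both x−y x+y)))
                           (≡.sym (total-both x−y y−x)) ⟩
          total nbr + total (both y x−y) + total (both x−y x+y) + total (both x−y y−x)
            ≡⟨ total-+₄ nbr (both y x−y) (both x−y x+y) (both x−y y−x) ⟨
          total (λ z → nbr z + both y x−y z + both x−y x+y z + both x−y y−x z)
            ≡⟨ total-cong (λ z → incl-excl₃ (z == y) (z == x−y) (z == y−x) (z == x+y)
                                   (==-apart z y≉y−x) (==-apart z y≉x+y)
                                   (==-apart z (==⇒≉ (≡.trans y−x=x+y β≡false)))) ⟩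
          total (λ z → at x−y z + at y−x z + at x+y z)
            ≡⟨ total-+₃ (at x−y) (at y−x) (at x+y) ⟩
          total (at x−y) + total (at y−x) + total (at x+y)
            ≡⟨ ≡.cong₂ _+_ (≡.cong₂ _+_ (total-at x−y) (total-at y−x)) (total-at x+y) ⟩
          3 ∎
          where
          open ≡.≡-Reasoning

        -- x = −x: then y − x = x + y, so only two candidates remain.
        degree-special : β ≡ true → degree x y + ⟦ y == x−y ⟧ + ⟦ x−y == y−x ⟧ ≡ 2
        degree-special β≡true = begin
          degree x y + ⟦ y == x−y ⟧ + ⟦ x−y == y−x ⟧
            ≡⟨ ≡.cong₂ _+_ (≡.cong₂ _+_ (≡.trans degree-total (total-cong merge))
                                        (≡.sym (total-both y x−y)))
                           (≡.sym (total-both x−y y−x)) ⟩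
          total nbr₂ + total (both y x−y) + total (both x−y y−x)
            ≡⟨ total-+₃ nbr₂ (both y x−y) (both x−y y−x) ⟨
          total (λ z → nbr₂ z + both y x−y z + both x−y y−x z)
            ≡⟨ total-cong (λ z → incl-excl₂ (z == y) (z == x−y) (z == y−x) (==-apart z y≉y−x)) ⟩
          total (λ z → at x−y z + at y−x z)
            ≡⟨ total-+ (at x−y) (at y−x) ⟩
          total (at x−y) + total (at y−x)
            ≡⟨ ≡.cong₂ _+_ (total-at x−y) (total-at y−x) ⟩
          2 ∎
          where
          open ≡.≡-Reasoning
          nbr₂ : Carrier → ℕ
          nbr₂ z = ⟦ not (z == y) ∧ ((z == x−y) ∨ (z == y−x)) ⟧
          merge : ∀ z → nbr z ≡ nbr₂ z
          merge z rewrite ≡.sym (==-congʳ {z} (==⇒≈ (≡.trans y−x=x+y β≡true)))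
                        | BoolP.∨-idem (z == y−x) = refl

        degree-identity : degree x y + ⟦ (y ∙ y) == x ⟧ + ⟦ y == (y ⁻¹) ⟧
                            + ⟦ not β ⟧ * ⟦ y−x == (y−x ⁻¹) ⟧ ≡ 2 + ⟦ not β ⟧
        degree-identity rewrite ≡.sym y=x−y | ≡.sym x−y=x+y | ≡.sym x−y=y−x with β in β-eq
        ... | false = ≡.trans (≡.cong (degree x y + ⟦ y == x−y ⟧ + ⟦ x−y == x+y ⟧ +_)
                                      (ℕP.+-identityʳ _))
                              (degree-generic β-eq)
        ... | true  = ≡.trans (ℕP.+-identityʳ _)
                              (≡.trans (≡.cong (λ b → degree x y + ⟦ y == x−y ⟧ + ⟦ b ⟧)
                                               (==-congʳ (sym (==⇒≈ (≡.trans y−x=x+y β-eq)))))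
                                       (degree-special β-eq))

      open Neighbourhood using (degree-identity)

      degree-≤3 : ∀ y → O y ≡ true → degree x y ≤ 3
      degree-≤3 y Oy = begin
        degree x y                                                   ≤⟨ ℕP.m≤m+n _ _ ⟩
        degree x y + ⟦ (y ∙ y) == x ⟧                                ≤⟨ ℕP.m≤m+n _ _ ⟩
        degree x y + ⟦ (y ∙ y) == x ⟧ + ⟦ y == (y ⁻¹) ⟧              ≤⟨ ℕP.m≤m+n _ _ ⟩
        degree x y + ⟦ (y ∙ y) == x ⟧ + ⟦ y == (y ⁻¹) ⟧
          + ⟦ not β ⟧ * ⟦ (y // x) == ((y // x) ⁻¹) ⟧               ≡⟨ degree-identity y Oy ⟩
        2 + ⟦ not β ⟧                                                ≤⟨ s≤s (s≤s (⟦⟧≤1 (not β))) ⟩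
        3                                                            ∎
        where open ℕP.≤-Reasoning

      degree-even : ∀ y → O y ≡ false → degree x y ≡ 0
      degree-even y Ey = ≡.trans (count-total (adj x y)) (total-zeros (λ z → ≡.cong ⟦_⟧ (no-edge z)))
        where
        no-edge : ∀ z → adj x y z ≡ false
        no-edge z rewrite Ey = refl

      -- The degree identity, weighted by [y ∈ 𝒪] so that it holds for every y ∈ G.
      weighted-identity : ∀ y →
        degree x y + ⟦ O y ∧ ((y ∙ y) == x) ⟧ + ⟦ O y ∧ (y == (y ⁻¹)) ⟧
          + ⟦ not β ⟧ * ⟦ O y ∧ ((y // x) == ((y // x) ⁻¹)) ⟧ ≡ (2 + ⟦ not β ⟧) * ⟦ O y ⟧
      weighted-identity y = by-parity (O y) refl
        where
        k : ℕ
        k = ⟦ not β ⟧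
        by-parity : ∀ o → O y ≡ o →
          degree x y + ⟦ o ∧ ((y ∙ y) == x) ⟧ + ⟦ o ∧ (y == (y ⁻¹)) ⟧
            + k * ⟦ o ∧ ((y // x) == ((y // x) ⁻¹)) ⟧ ≡ (2 + k) * ⟦ o ⟧
        by-parity true  Oy = ≡.trans (degree-identity y Oy) (≡.sym (ℕP.*-identityʳ (2 + k)))
        by-parity false Ey rewrite degree-even y Ey | ℕP.*-zeroʳ k = refl

      adj-sym : ∀ y z → adj x y z ≡ adj x z y
      adj-sym y z rewrite ==-sym {y} {z} | ==-congˡ {y ∙ z} {z ∙ y} {x} (comm y z)
                        | BoolP.∨-comm ((y // z) == x) ((z // y) == x) = ∧-swap (O y) (O z) _

      adj-irrefl : ∀ y → adj x y y ≡ false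
      adj-irrefl y rewrite ≈⇒== (≈-refl {y}) | BoolP.∧-zeroʳ (O y) | BoolP.∧-zeroʳ (O y) = refl

      total-degrees : total (degree x) ≡ 2 * edges x
      total-degrees = ≡.trans (total-cong (λ y → count-total (adj x y)))
        (≡.sym (handshake _ (λ i j → adj x (from i) (from j)) (λ _ _ → refl)
                          (λ i j → adj-sym (from i) (from j)) (adj-irrefl ∘ from)))

      -- ∑_{y ∈ 𝒪} [2y = x] = r(ℰ)·[x ∈ W]: if x = 2a with a ∈ 𝒪, then y = w + a
      -- maps ℰ onto 𝒪, and 2(w + a) = x iff 2w = 0.
      total-halves : total (λ y → ⟦ O y ∧ ((y ∙ y) == x) ⟧) ≡ r E * ⟦ inW x ⟧
      total-halves with inW x in x∈W
      ... | false = ≡.trans (≡.sym (count-total halves))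
                            (≡.trans (count-none halves elems x∈W) (≡.sym (ℕP.*-zeroʳ (r E))))
        where
        halves : Carrier → Bool
        halves a = O a ∧ ((a ∙ a) == x)
      ... | true with any-witness (λ a → O a ∧ ((a ∙ a) == x)) elems x∈W
      ...   | a , a-half = begin
        total (λ y → ⟦ O y ∧ ((y ∙ y) == x) ⟧)
          ≡⟨ total-invariant (translation a) (λ y → ⟦ O y ∧ ((y ∙ y) == x) ⟧) half-resp ⟩
        total (λ w → ⟦ O (w ∙ a) ∧ (((w ∙ a) ∙ (w ∙ a)) == x) ⟧)
          ≡⟨ total-cong (λ w → ≡.cong₂ (λ p q → ⟦ p ∧ q ⟧) (O-∙odd Oa w) (shifted-half w)) ⟩
        total (λ w → ⟦ E w ∧ (w == (w ⁻¹)) ⟧)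
          ≡⟨ count-total (inR E) ⟨
        r E
          ≡⟨ ℕP.*-identityʳ (r E) ⟨
        r E * 1 ∎
        where
        open ≡.≡-Reasoning
        Oa : O a ≡ true
        Oa = BoolP.∧-conicalˡ (O a) _ a-half
        a+a≈x : a ∙ a ≈ x
        a+a≈x = ==⇒≈ (BoolP.∧-conicalʳ (O a) _ a-half)
        half-resp : ∀ {u v} → u ≈ v → ⟦ O u ∧ ((u ∙ u) == x) ⟧ ≡ ⟦ O v ∧ ((v ∙ v) == x) ⟧
        half-resp u≈v = ≡.cong₂ (λ p q → ⟦ p ∧ q ⟧) (≡.cong not (respects u≈v))
                                                   (==-congˡ (∙-cong u≈v u≈v))
        shifted-half : ∀ w → (((w ∙ a) ∙ (w ∙ a)) == x) ≡ (w == (w ⁻¹))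
        shifted-half w = begin
          (((w ∙ a) ∙ (w ∙ a)) == x) ≡⟨ ==-congˡ (trans (interchange w a w a) (∙-congˡ a+a≈x)) ⟩
          (((w ∙ w) ∙ x) == x)       ≡⟨ ==-⇔ (identityˡ-unique (w ∙ w) x)
                                             (λ ww≈ε → trans (∙-congʳ ww≈ε) (identityˡ x)) ⟩
          ((w ∙ w) == ε)             ≡⟨ ==-⇔ (inverseˡ-unique w w)
                                             (λ w≈w⁻¹ → trans (∙-congˡ w≈w⁻¹) (inverseʳ w)) ⟩
          (w == (w ⁻¹))              ∎

      -- ∑_{y ∈ 𝒪} [y − x ∈ R] = r(𝒪), as y ↦ y − x permutes 𝒪.
      total-shifted-involutions : total (λ y → ⟦ O y ∧ ((y // x) == ((y // x) ⁻¹)) ⟧) ≡ r O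
      total-shifted-involutions = begin
        total (λ y → ⟦ O y ∧ ((y // x) == ((y // x) ⁻¹)) ⟧)
          ≡⟨ total-cong (λ y → ≡.cong (λ o → ⟦ o ∧ ((y // x) == ((y // x) ⁻¹)) ⟧)
                                      (≡.sym (O-∙even y (⁻¹-mem Ex)))) ⟩
        total (λ y → ⟦ inR O (y // x) ⟧)
          ≡⟨ total-invariant (translation (x ⁻¹)) (λ u → ⟦ inR O u ⟧) inR-resp ⟨
        total (λ u → ⟦ inR O u ⟧)
          ≡⟨ count-total (inR O) ⟨
        r O ∎
        where
        open ≡.≡-Reasoning
        inR-resp : ∀ {u v} → u ≈ v → ⟦ inR O u ⟧ ≡ ⟦ inR O v ⟧
        inR-resp u≈v = ≡.cong₂ (λ p q → ⟦ p ∧ q ⟧) (≡.cong not (respects u≈v))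
                                                   (≡.trans (==-congˡ u≈v) (==-congʳ (⁻¹-cong u≈v)))

      edge-count : 2 * edges x + r E * ⟦ inW x ⟧ + r O + ⟦ not β ⟧ * r O ≡ (2 + ⟦ not β ⟧) * n
      edge-count = begin
        2 * edges x + r E * ⟦ inW x ⟧ + r O + k * r O
          ≡⟨ ≡.cong₂ _+_ (≡.cong₂ _+_ (≡.cong₂ _+_ (≡.sym total-degrees) (≡.sym total-halves))
                                      (count-total (inR O)))
                         (≡.cong (k *_) (≡.sym total-shifted-involutions)) ⟩
        total (degree x) + total halves + total involutions + k * total shifted
          ≡⟨ ≡.cong (total (degree x) + total halves + total involutions +_) (total-* k shifted) ⟨
        total (degree x) + total halves + total involutions + total (λ y → k * shifted y)
          ≡⟨ total-+₄ (degree x) halves involutions (λ y → k * shifted y) ⟨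
        total (λ y → degree x y + halves y + involutions y + k * shifted y)
          ≡⟨ total-cong weighted-identity ⟩
        total (λ y → (2 + k) * ⟦ O y ⟧)
          ≡⟨ total-* (2 + k) (λ y → ⟦ O y ⟧) ⟩
        (2 + k) * total (λ y → ⟦ O y ⟧)
          ≡⟨ ≡.cong ((2 + k) *_) |𝒪| ⟩
        (2 + k) * n ∎
        where
        open ≡.≡-Reasoning
        k : ℕ
        k = ⟦ not β ⟧
        halves involutions shifted : Carrier → ℕ
        halves y      = ⟦ O y ∧ ((y ∙ y) == x) ⟧
        involutions y = ⟦ O y ∧ (y == (y ⁻¹)) ⟧
        shifted y     = ⟦ O y ∧ ((y // x) == ((y // x) ⁻¹)) ⟧

lemma3p3 : ∀ {c ℓ : Level} (G : AbelianGroup c ℓ) (n : ℕ)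
             (enum : Inverse (AbelianGroup.setoid G) (≡.setoid (Fin (2 * n))))
             (E : AbelianGroup.Carrier G → Data.Bool.Bool) →
           let open AbelianGroup G
               open FiniteAbGroup G (2 * n) enum
               open WithEven E
           in IsSubgroup E → HasIndex2 E →
              ∀ (x : Carrier) → E x ≡ true → ¬ (x ≈ ε) →
              (ℤ.+ 2 ℤ.* ℤ.+ (edges x)
                 ≡ ℤ.+ (2 * n) ℤ.- ℤ.+ (r O) ℤ.- ℤ.+ (r E) ℤ.* 𝟙 (inW x)
                   ℤ.+ (ℤ.+ n ℤ.- ℤ.+ (r O)) ℤ.* 𝟙 (not (x == (x ⁻¹))))
              × (∀ (y : Carrier) → O y ≡ true → degree x y ≤ 3)
lemma3p3 G n enum E ℰ-subgroup index2 x Ex x≉ε =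
  signed-form (edges x) n (r O) (r E) (inW x) (not β) edge-count , degree-≤3
  where
  open FiniteAbGroup G (2 * n) enum using (r)
  open FiniteAbGroup.WithEven G (2 * n) enum E using (O; inW; edges)
  open EvenOddGraph.Index2.Vertex G n enum E ℰ-subgroup index2 x Ex x≉ε
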